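{- For any formula $\varphi\in\mathcal L^+$ and any pointed simplicial model $(\mathcal C,X)$, $$\mathcal C,X\bowtie\varphi\iff\mathcal C,X\bowtie\mathfrak T_\varphi,$$ i.e. $\varphi$ is defined at $X$ if and only if the formula life tree $\mathfrak T_\varphi$ has an embedding into $(\mathcal C,X)$.
   Context: Let $A$ be a finite set of agents and $P=A\sqcup\bigsqcup_{a\in A}P_a$, where the $P_a$ are countable, pairwise disjoint sets of local atoms (disjoint from $A$); each $a\in A$ is also a global atom. $\mathcal L^+$: $\varphi::=a\mid p_a\mid\neg\varphi\mid(\varphi\wedge\varphi)\mid\widehat K_a\varphi$. A simplicial model $\mathcal C=(C,\chi,\ell)$: $C$ a nonempty set of nonempty finite subsets (simplexes) of a vertex set $\mathcal V$, closed under nonempty subsets and containing all singletons; $\chi:\mathcal V\to A$ injective on each simplex; $\ell:\mathcal V\to 2^{P\setminus A}$ with $\ell(v)\subseteq P_{\chi(v)}$. $\chi(X)=\{\chi(v)\mid v\in X\}$. Facets are maximal simplexes, $\mathcal F(C)$ the set of facets; a pointed model is $(\mathcal C,X)$ with $X\in\mathcal F(C)$. Definability at a facet $X$: $\mathcal C,X\bowtie a$ always; $\mathcal C,X\bowtie p_a$ iff $a\in\chi(X)$; $\neg\varphi$ defined iff $\varphi$ is; $\varphi\wedge\psi$ defined iff both are; $\mathcal C,X\bowtie\widehat K_a\varphi$ iff $\mathcal C,Y\bowtie\varphi$ for some $Y\in\mathcal F(C)$ with $a\in\chi(X\cap Y)$. A life tree $\mathfrak T=(\mathcal T,\lambda)$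 is a directed rooted tree $\mathcal T=(V,E)$ with labels $\lambda(\sigma)\subseteq A$ on nodes and $\lambda(\sigma,\tau)\in A$ on edges satisfying $\lambda(\sigma,\tau)\in\lambda(\sigma)\cap\lambda(\tau)$. Its $a$-grafting $\mathfrak T^a$ adds $a$ to the root label. The formula life tree $\mathfrak T_\varphi$: $\mathfrak T_a$ is a single root labeled $\varnothing$; $\mathfrak T_{p_a}$ a single root labeled $\{a\}$; $\mathfrak T_{\neg\varphi}=\mathfrak T_\varphi$; $\mathfrak T_{\varphi\wedge\psi}$ is the disjoint union of $\mathfrak T_\varphi,\mathfrak T_\psi$ with roots merged into one root labeled by the union of the root labels; $\mathfrak T_{\widehat K_a\varphi}$ adds to $\mathfrak T_\varphi^a$ a new root labeled $\{a\}$ with an $a$-labeled edge to the root of $\mathfrak T_\varphi^a$. An embedding of a life tree $\mathfrak T=((V,E),\lambda)$ with root $\rho$ into $(\mathcal C,X)$ is a map $e:V\to\mathcal F(C)$ with $e(\rho)=X$, $\lambda(\sigma)\subseteq\chi(e(\sigma))$ for all $\sigma\in V$, and $\lambda(\sigma,\tau)\in\chi(e(\sigma)\cap e(\tau))$ for all $(\sigma,\tau)\in E$. We write $\mathcal C,X\bowtie\mathfrak T$ if an embedding exists. -}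

module Defs where

open import Level using (0ℓ)
open import Data.Nat using (ℕ)
open import Data.Fin using (Fin)
open import Data.Bool using (Bool)
open import Data.List using (List; []; _∷_; _++_; [_])
open import Data.List.Membership.Propositional using (_∈_)
open import Data.List.Relation.Unary.All using (All)
open import Data.Product using (Σ; ∃; _×_; _,_; proj₁)
open import Data.Unit using (⊤)
open import Relation.Binary.PropositionalEquality using (_≡_)
open import Relation.Nullary using (¬_)

-- Agents: a finite set A, represented as Fin n.
-- Local atoms of agent a: an arbitrary type LocalAtom a (the P_a; disjointness
-- is automatic since a local atom is always tagged by its agent).

module Syntax (n : ℕ) (LocalAtom : Fin n → Set) where

  Agent : Set
  Agent = Fin n

  data Form : Set where
    ag   : Agent → Form
    loc  : (a : Agent) → LocalAtom a → Form
    ¬'_  : Form → Form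
    _∧'_ : Form → Form → Form
    K̂    : Agent → Form → Form

  data LifeTree : Set where
    node : List Agent → List (Agent × LifeTree) → LifeTree

  graft : Agent → LifeTree → LifeTree
  graft a (node l cs) = node (a ∷ l) cs

  tree : Form → LifeTree
  tree (ag a)    = node [] []
  tree (loc a p) = node [ a ] []
  tree (¬' φ)    = tree φ
  tree (φ ∧' ψ) with tree φ | tree ψ
  ... | node l₁ c₁ | node l₂ c₂ = node (l₁ ++ l₂) (c₁ ++ c₂)
  tree (K̂ a φ)   = node [ a ] [ (a , graft a (tree φ)) ]

  -- Simplicial models. Simplexes are nonempty finite subsets of the vertex
  -- set V, represented as (duplicate-tolerant) lists; subset is list inclusion.
  _⊆_ : {V : Set} → List V → List V → Set
  X ⊆ Y = ∀ {v} → v ∈ X → v ∈ Y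

  record SimplicialModel : Set₁ where
    field
      V        : Set
      Simplex  : List V → Set            -- membership in C
      χ        : V → Agent
      ℓ        : (v : V) → LocalAtom (χ v) → Bool   -- ℓ(v) ⊆ P_{χ(v)}
      nonemptyC    : ∃ λ X → Simplex X
      simplex-ne   : ∀ X → Simplex X → ¬ (X ≡ [])
      down-closed  : ∀ X Y → Simplex X → ¬ (Y ≡ []) → Y ⊆ X → Simplex Y
      singletons   : ∀ v → Simplex [ v ]
      χ-inj        : ∀ X → Simplex X → ∀ {v w} → v ∈ X → w ∈ X → χ v ≡ χ w → v ≡ w

  module _ (M : SimplicialModel) where
    open SimplicialModel M

    IsFacet : List V → Set
    IsFacet X = Simplex X × (∀ Y → Simplex Y → X ⊆ Y → Y ⊆ X)

    Facet : Set
    Facet = Σ (List V) IsFacet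

    _∈χ_ : Agent → List V → Set
    a ∈χ X = ∃ λ v → v ∈ X × χ v ≡ a

    _∈χ∩_,_ : Agent → List V → List V → Set
    a ∈χ∩ X , Y = ∃ λ v → v ∈ X × v ∈ Y × χ v ≡ a

    Defined : Form → Facet → Set
    Defined (ag a)    X = ⊤
    Defined (loc a p) X = a ∈χ proj₁ X
    Defined (¬' φ)    X = Defined φ X
    Defined (φ ∧' ψ)  X = Defined φ X × Defined ψ X
    Defined (K̂ a φ)   X = ∃ λ (Y : Facet) → (a ∈χ∩ proj₁ X , proj₁ Y) × Defined φ Y

    mutual
      Embeds : LifeTree → Facet → Set
      Embeds (node l cs) X = All (λ a → a ∈χ proj₁ X) l × EmbedsChildren cs X

      EmbedsChildren : List (Agent × LifeTree) → Facet → Set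
      EmbedsChildren []             X = ⊤
      EmbedsChildren ((b , t) ∷ cs) X =
        (∃ λ (Y : Facet) → (b ∈χ∩ proj₁ X , proj₁ Y) × Embeds t Y) × EmbedsChildren cs X

{-# OPTIONS --safe #-}
module Submission where

open import Defs
open import Data.Nat using (ℕ)
open import Data.Fin using (Fin)
open import Data.List using ([]; _∷_; _++_; [_])
open import Data.List.Relation.Unary.All using ([]; _∷_)
open import Data.List.Relation.Unary.All.Properties using (++⁺; ++⁻)
open import Data.Product using (∃; _×_; _,_; proj₁; proj₂)
open import Data.Product.Function.Dependent.Propositional using (congˡ)
open import Data.Product.Function.NonDependent.Propositional using (_×-⇔_)
open import Data.Unit using (tt)
open import Function.Bundles using (_⇔_; mk⇔; module Equivalence)
open import Function.Properties.Equivalence using (refl; trans; sym)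

module _ (n : ℕ) (LocalAtom : Fin n → Set) where
  open Syntax n LocalAtom

  module _ (M : SimplicialModel) where

    EmbedsChildren-++ : ∀ cs ds X →
      EmbedsChildren M (cs ++ ds) X ⇔ (EmbedsChildren M cs X × EmbedsChildren M ds X)
    EmbedsChildren-++ cs ds X = mk⇔ (split cs) (λ (ecs , eds) → join cs ecs eds)
      where
      split : ∀ cs → EmbedsChildren M (cs ++ ds) X → EmbedsChildren M cs X × EmbedsChildren M ds X
      split []       eds        = tt , eds
      split (_ ∷ cs) (ec , ecs) = let (ecs′ , eds) = split cs ecs in (ec , ecs′) , eds

      join : ∀ cs → EmbedsChildren M cs X → EmbedsChildren M ds X → EmbedsChildren M (cs ++ ds) X
      join []       _          eds = eds
      join (_ ∷ cs) (ec , ecs) eds = ec , join cs ecs eds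

    Embeds-merge : ∀ l₁ l₂ c₁ c₂ X →
      Embeds M (node (l₁ ++ l₂) (c₁ ++ c₂)) X ⇔ (Embeds M (node l₁ c₁) X × Embeds M (node l₂ c₂) X)
    Embeds-merge l₁ l₂ c₁ c₂ X = mk⇔
      (λ (al , ec) → let (al₁ , al₂) = ++⁻ l₁ al
                         (ec₁ , ec₂) = Equivalence.to (EmbedsChildren-++ c₁ c₂ X) ec
                     in (al₁ , ec₁) , (al₂ , ec₂))
      (λ ((al₁ , ec₁) , (al₂ , ec₂)) → ++⁺ al₁ al₂ , Equivalence.from (EmbedsChildren-++ c₁ c₂ X) (ec₁ , ec₂))

    Embeds-graft : ∀ a t X → Embeds M (graft a t) X ⇔ (_∈χ_ M a (proj₁ X) × Embeds M t X)
    Embeds-graft a (node l cs) X = mk⇔ (λ { ((a∈X ∷ al) , ec) → a∈X , (al , ec) })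
                                       (λ (a∈X , (al , ec)) → (a∈X ∷ al) , ec)

    -- Both extra labels a are redundant: a vertex of colour a in X ∩ Y puts a into χ(X) and into χ(Y).
    Embeds-graftedChild : ∀ a t X →
      Embeds M (node [ a ] [ (a , graft a t) ]) X ⇔ ∃ λ Y → _∈χ∩_,_ M a (proj₁ X) (proj₁ Y) × Embeds M t Y
    Embeds-graftedChild a t X = mk⇔
      (λ (_ , ((Y , a∈X∩Y , et) , _)) → Y , a∈X∩Y , proj₂ (Equivalence.to (Embeds-graft a t Y) et))
      (λ (Y , a∈X∩Y@(v , v∈X , v∈Y , χv≡a) , et) →
         ((v , v∈X , χv≡a) ∷ []) ,
         ((Y , a∈X∩Y , Equivalence.from (Embeds-graft a t Y) ((v , v∈Y , χv≡a) , et)) , tt))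

    Embeds-tree-∧ : ∀ φ ψ X → Embeds M (tree (φ ∧' ψ)) X ⇔ (Embeds M (tree φ) X × Embeds M (tree ψ) X)
    Embeds-tree-∧ φ ψ X with tree φ | tree ψ
    ... | node l₁ c₁ | node l₂ c₂ = Embeds-merge l₁ l₂ c₁ c₂ X

    Defined⇔Embeds-tree : ∀ φ X → Defined M φ X ⇔ Embeds M (tree φ) X
    Defined⇔Embeds-tree (ag a)    X = mk⇔ (λ _ → [] , tt) (λ _ → tt)
    Defined⇔Embeds-tree (loc a p) X = mk⇔ (λ a∈X → (a∈X ∷ []) , tt) (λ { ((a∈X ∷ []) , _) → a∈X })
    Defined⇔Embeds-tree (¬' φ)    X = Defined⇔Embeds-tree φ X
    Defined⇔Embeds-tree (φ ∧' ψ)  X =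
      trans (Defined⇔Embeds-tree φ X ×-⇔ Defined⇔Embeds-tree ψ X) (sym (Embeds-tree-∧ φ ψ X))
    Defined⇔Embeds-tree (K̂ a φ)   X =
      trans (congˡ (λ {Y} → refl ×-⇔ Defined⇔Embeds-tree φ Y)) (sym (Embeds-graftedChild a (tree φ) X))

lemma4p9 : (n : ℕ) (LocalAtom : Fin n → Set) →
    let open Syntax n LocalAtom in
    (M : SimplicialModel) (φ : Form) (X : Facet M) →
      Defined M φ X ⇔ Embeds M (tree φ) X
lemma4p9 = Defined⇔Embeds-tree
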